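{- Let $G=(V,E)$ be a capacitated graph, let $U\subseteq V$, and let $G'$ be obtained from $G$ by adding a new vertex $x$ (with arbitrary capacity) adjacent to exactly one vertex of $G$. Then $\mathsf{cvc}(G',U)=\mathsf{cvc}(G,U)$, or $\mathsf{cvc}(G',U)=\mathsf{cvc}(G,U)+1$, or $\mathsf{cvc}(G',U)=\infty$.
   Context: A capacitated graph is a finite simple graph $G=(V,E)$ with a capacity function $c:V\rightarrow\mathbb{N}_0$. A set $C\subseteq V$ is a capacitated vertex cover of $G$ if there is a mapping $f:E\rightarrow C$ sending every edge to one of its endpoints such that for every $v\in C$ at most $c(v)$ edges are mapped to $v$. For $U\subseteq V$, $\mathsf{cvc}(G,U)$ is the minimum cardinality of a capacitated vertex cover $C\subseteq U$ of $G$, and $\mathsf{cvc}(G,U)=\infty$ if no such cover exists (with $\infty+1=\infty$). -}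

module Defs where

open import Data.Nat using (ℕ; zero; suc; _+_; _≤_; _<?_)
open import Data.Fin using (Fin; zero; suc; toℕ; _≟_)
open import Data.Fin.Subset using (Subset; _∈_; _⊆_; ∣_∣; outside)
open import Data.Bool using (Bool; true; false; _∧_; if_then_else_)
open import Data.List using (List; allFin; cartesianProduct; filterᵇ; length)
open import Data.Product using (_×_; _,_; Σ; ∃)
open import Data.Maybe using (Maybe; just; nothing)
open import Relation.Nullary.Decidable using (⌊_⌋)
open import Relation.Binary.PropositionalEquality using (_≡_)
open import Data.Empty using (⊥)
open import Data.Vec using (_∷_)

-- The edge set is encoded by `adj`, which is only consulted on pairs (i , j)
-- with toℕ i < toℕ j; thus {i , j} (i < j) is an edge iff adj i j ≡ true.
-- This encodes exactly the simple graphs (no loops, no multi-edges).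
record CGraph (n : ℕ) : Set where
  field
    adj : Fin n → Fin n → Bool
    cap : Fin n → ℕ
open CGraph public

isEdge : ∀ {n} → CGraph n → Fin n × Fin n → Bool
isEdge G (i , j) = ⌊ toℕ i <? toℕ j ⌋ ∧ adj G i j

allPairs : ∀ n → List (Fin n × Fin n)
allPairs n = cartesianProduct (allFin n) (allFin n)

-- A mapping of edges to endpoints: for the edge {i , j} with i < j,
-- f i j ≡ true means the edge is mapped to i, false means mapped to j.
Assignment : ℕ → Set
Assignment n = Fin n → Fin n → Bool

target : ∀ {n} → Assignment n → Fin n × Fin n → Fin n
target f (i , j) = if f i j then i else j

load : ∀ {n} → CGraph n → Assignment n → Fin n → ℕ
load {n} G f v = length (filterᵇ (λ e → isEdge G e ∧ ⌊ target f e ≟ v ⌋) (allPairs n))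

IsCVC : ∀ {n} → CGraph n → Subset n → Set
IsCVC {n} G C = Σ (Assignment n) λ f →
    (∀ i j → isEdge G (i , j) ≡ true → target f (i , j) ∈ C)
  × (∀ v → v ∈ C → load G f v ≤ cap G v)

-- ℕ ∪ {∞}: `nothing` is ∞.
ℕ∞ : Set
ℕ∞ = Maybe ℕ

suc∞ : ℕ∞ → ℕ∞
suc∞ (just k) = just (suc k)
suc∞ nothing  = nothing

data CvcIs {n} (G : CGraph n) (U : Subset n) : ℕ∞ → Set where
  finite : ∀ (C : Subset n) → C ⊆ U → IsCVC G C →
           (∀ (D : Subset n) → D ⊆ U → IsCVC G D → ∣ C ∣ ≤ ∣ D ∣) →
           CvcIs G U (just ∣ C ∣)
  infinite : (∀ (D : Subset n) → D ⊆ U → IsCVC G D → ⊥) → CvcIs G U nothing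

-- G' : add a new vertex x (represented as vertex `zero` of Fin (suc n),
-- old vertex i becomes `suc i`) with capacity cx, adjacent exactly to y.
addPendant : ∀ {n} → CGraph n → (cx : ℕ) → (y : Fin n) → CGraph (suc n)
addPendant G cx y = record { adj = a ; cap = c }
  where
    a : _ → _ → Bool
    a zero    (suc j) = ⌊ j ≟ y ⌋
    a (suc i) (suc j) = adj G i j
    a _       _       = false
    c : _ → ℕ
    c zero    = cx
    c (suc i) = cap G i

liftU : ∀ {n} → Subset n → Subset (suc n)
liftU U = outside ∷ U

-- Since x ∉ U, a capacitated
-- cover D′ ⊆ U of G′ must send the edge xy to y, so y ∈ D′ and cap y ≥ 1; dropping x turns D′
-- into a cover of G, whence cvc(G , U) ≤ cvc(G′ , U). Conversely, take an optimal cover C of G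
-- and send xy to y. If y ∉ C, add y: its load is 1 ≤ cap y. Otherwise y may carry one edge too
-- many. While the current vertex z is overloaded, its load exceeds the load D′ puts on it, so D′
-- sends some edge at z elsewhere; hand that edge over to its D′-endpoint w, which becomes the
-- current vertex (added to the cover if new, with load 1 ≤ cap w). Every hand-over lowers the
-- disagreement with D′, so the process stops, having added at most one vertex of D′.
module Submission where

open import Data.Bool.Base using (Bool; true; false; _∧_; not; if_then_else_)
open import Data.Bool.Properties using (∧-conicalˡ; ∧-conicalʳ)
open import Data.Empty using (⊥-elim)
open import Data.Fin using (Fin; zero; suc; _≟_; toℕ)
open import Data.Fin.Properties using (suc-injective)
open import Data.Fin.Subset using (Subset; _∈_; _∉_; _⊆_; ∣_∣; _∪_; ⁅_⁆; outside; inside)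
open import Data.Fin.Subset.Properties
  using (_∈?_; p⊆p∪q; q⊆p∪q; x∈p∪q⁻; x∈p∪q⁺; x∈⁅x⁆; x∈⁅y⁆⇒x≡y; ∣⁅x⁆∣≡1; ∣p∣≤∣x∷p∣;
         drop-there; drop-∷-⊆; out⊆; ⊆-trans)
open import Data.List using ([]; _∷_; _++_; map; tabulate; cartesianProduct; filterᵇ; length)
open import Data.List.Properties using (filter-++; length-++)
open import Data.Maybe using (nothing; just)
open import Data.Nat using (ℕ; zero; suc; _+_; _≤_; _<_; _≤?_; _<?_; z≤n; s≤s; s≤s⁻¹; z<s)
open import Data.Nat.Properties
  using (≤-refl; ≤-trans; ≤-reflexive; ≤-antisym; ≤-<-trans; <⇒≱; ≰⇒>; ≮⇒≥; m≤n⇒m<n∨m≡n;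
         +-comm; +-assoc; +-suc; +-identityʳ; +-mono-≤; +-monoˡ-≤; +-monoʳ-≤; +-cancelˡ-<; +-cancelʳ-≡;
         m≤m+n; m≤n+m; module ≤-Reasoning)
open import Data.Nat.Tactic.RingSolver using (solve-∀)
open import Data.Product using (∃-syntax; _×_; _,_; proj₁; proj₂)
open import Data.Product.Properties using (≡-dec)
open import Data.Sum using (_⊎_; inj₁; inj₂; [_,_]; map₂)
open import Data.Vec using (here; there) renaming ([] to []ᵥ; _∷_ to _∷ᵥ_)
open import Function using (_∘_; id; _⇔_; mk⇔)
open import Relation.Nullary using (Dec; yes; no; ¬_; contradiction)
open import Relation.Nullary.Decidable using (⌊_⌋; T?; dec-true; dec-false; does-⇔; isYes≗does)
open import Relation.Binary.PropositionalEquality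
  using (_≡_; _≢_; refl; sym; trans; cong; cong₂; subst; subst₂; module ≡-Reasoning)

open import Defs

private
  variable
    A B : Set
    m n : ℕ

𝟙 : Bool → ℕ
𝟙 true  = 1
𝟙 false = 0

𝟙≤1 : ∀ b → 𝟙 b ≤ 1
𝟙≤1 true  = ≤-refl
𝟙≤1 false = z≤n

𝟙-<⇒ : ∀ {a b} → 𝟙 b < 𝟙 a → a ≡ true × b ≡ false
𝟙-<⇒ {true} {false} _        = refl , refl
𝟙-<⇒ {true} {true}  (s≤s ())

𝟙-shift : ∀ {a b p q} → a + 𝟙 p ≡ b + 𝟙 q → p ≡ true → q ≡ false → b ≡ suc a
𝟙-shift {a} {b} eq refl refl = trans (sym (+-identityʳ b)) (trans (sym eq) (+-comm a 1))

𝟙-cancel : ∀ {a b p q} → a + 𝟙 p ≡ b + 𝟙 q → p ≡ false → q ≡ false → a ≡ b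
𝟙-cancel {a} {b} eq refl refl = trans (sym (+-identityʳ a)) (trans eq (+-identityʳ b))

⌊⌋-true : ∀ {P : Set} (p? : Dec P) → P → ⌊ p? ⌋ ≡ true
⌊⌋-true p? p = trans (isYes≗does p?) (dec-true p? p)

⌊⌋-false : ∀ {P : Set} (p? : Dec P) → ¬ P → ⌊ p? ⌋ ≡ false
⌊⌋-false p? ¬p = trans (isYes≗does p?) (dec-false p? ¬p)

⌊⌋-true⇒ : ∀ {P : Set} (p? : Dec P) → ⌊ p? ⌋ ≡ true → P
⌊⌋-true⇒ (yes p) _ = p

⌊⌋-⇔ : ∀ {P Q : Set} → P ⇔ Q → (p? : Dec P) (q? : Dec Q) → ⌊ p? ⌋ ≡ ⌊ q? ⌋
⌊⌋-⇔ P⇔Q p? q? = trans (isYes≗does p?) (trans (does-⇔ P⇔Q p? q?) (sym (isYes≗does q?)))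

∑ : (Fin n → ℕ) → ℕ
∑ {zero}  f = 0
∑ {suc n} f = f zero + ∑ (f ∘ suc)

∑-cong : {f g : Fin n → ℕ} → (∀ k → f k ≡ g k) → ∑ f ≡ ∑ g
∑-cong {zero}  f≗g = refl
∑-cong {suc n} f≗g = cong₂ _+_ (f≗g zero) (∑-cong (f≗g ∘ suc))

∑-zero : {f : Fin n → ℕ} → (∀ k → f k ≡ 0) → ∑ f ≡ 0
∑-zero {zero}  f≗0 = refl
∑-zero {suc n} f≗0 = cong₂ _+_ (f≗0 zero) (∑-zero (f≗0 ∘ suc))

∑-≥ : ∀ (f : Fin n → ℕ) k → f k ≤ ∑ f
∑-≥ f zero    = m≤m+n _ _
∑-≥ f (suc k) = ≤-trans (∑-≥ (f ∘ suc) k) (m≤n+m _ _)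

∑-swap : {f g : Fin n → ℕ} (a : Fin n) → (∀ k → k ≢ a → f k ≡ g k) → ∑ f + g a ≡ ∑ g + f a
∑-swap {suc n} {f} {g} zero f≈g = begin
  f zero + ∑ (f ∘ suc) + g zero  ≡⟨ cong (λ s → f zero + s + g zero) (∑-cong λ k → f≈g (suc k) λ ()) ⟩
  f zero + ∑ (g ∘ suc) + g zero  ≡⟨ exchange (f zero) _ (g zero) ⟩
  g zero + ∑ (g ∘ suc) + f zero  ∎
  where
    open ≡-Reasoning
    exchange : ∀ a s b → a + s + b ≡ b + s + a
    exchange = solve-∀
∑-swap {suc n} {f} {g} (suc a) f≈g = begin
  f zero + ∑ (f ∘ suc) + g (suc a)    ≡⟨ +-assoc (f zero) _ _ ⟩
  f zero + (∑ (f ∘ suc) + g (suc a))  ≡⟨ cong₂ _+_ (f≈g zero λ ()) (∑-swap a λ k k≢a → f≈g (suc k) (k≢a ∘ suc-injective)) ⟩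
  g zero + (∑ (g ∘ suc) + f (suc a))  ≡⟨ +-assoc (g zero) _ _ ⟨
  g zero + ∑ (g ∘ suc) + f (suc a)    ∎
  where open ≡-Reasoning

∑-single : {f : Fin n → ℕ} (a : Fin n) → (∀ k → k ≢ a → f k ≡ 0) → ∑ f ≡ f a
∑-single {n} {f} a f≈0 = begin
  ∑ f                    ≡⟨ +-identityʳ (∑ f) ⟨
  ∑ f + 0                ≡⟨ ∑-swap {g = λ _ → 0} a f≈0 ⟩
  ∑ {n} (λ _ → 0) + f a  ≡⟨ cong (_+ f a) (∑-zero {n} λ _ → refl) ⟩
  f a                    ∎
  where open ≡-Reasoning

∑-<⇒ : {f g : Fin n → ℕ} → ∑ g < ∑ f → ∃[ k ] g k < f k
∑-<⇒ {suc n} {f} {g} Σg<Σf with g zero <? f zero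
... | yes g₀<f₀ = zero , g₀<f₀
... | no  g₀≮f₀ with ∑-<⇒ (+-cancelˡ-< (f zero) _ _ (≤-<-trans (+-monoˡ-≤ _ (≮⇒≥ g₀≮f₀)) Σg<Σf))
...   | k , gk<fk = suc k , gk<fk

count : (Fin n → Bool) → ℕ
count P = ∑ λ k → 𝟙 (P k)

count² : (Fin n × Fin n → Bool) → ℕ
count² P = ∑ λ i → count λ j → P (i , j)

count²-zero : {P : Fin n × Fin n → Bool} → (∀ e → P e ≡ false) → count² P ≡ 0
count²-zero P≗false = ∑-zero λ i → ∑-zero λ j → cong 𝟙 (P≗false (i , j))

count²-≥1 : (P : Fin n × Fin n → Bool) (e : Fin n × Fin n) → P e ≡ true → 1 ≤ count² P
count²-≥1 P (i , j) Pe = ≤-trans (≤-reflexive (cong 𝟙 (sym Pe)))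
  (≤-trans (∑-≥ (λ j → 𝟙 (P (i , j))) j) (∑-≥ (λ i → count λ j → P (i , j)) i))

count²-<⇒ : {P Q : Fin n × Fin n → Bool} → count² Q < count² P → ∃[ e ] P e ≡ true × Q e ≡ false
count²-<⇒ rows< with ∑-<⇒ rows<
... | i , row< with ∑-<⇒ row<
...   | j , entry< = (i , j) , 𝟙-<⇒ entry<

count²-swap : {P Q : Fin n × Fin n → Bool} (e : Fin n × Fin n) → (∀ e′ → e′ ≢ e → P e′ ≡ Q e′) →
              count² P + 𝟙 (Q e) ≡ count² Q + 𝟙 (P e)
count²-swap {P = P} {Q} (a , b) P≈Q = combine {u = count λ j → P (a , j)} {v = count λ j → Q (a , j)}
  (∑-swap a λ i i≢a → ∑-cong λ j → cong 𝟙 (P≈Q (i , j) (i≢a ∘ cong proj₁)))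
  (∑-swap b λ j j≢b → cong 𝟙 (P≈Q (a , j) (j≢b ∘ cong proj₂)))
  where
    combine : ∀ {x y u v s t} → x + v ≡ y + u → u + s ≡ v + t → x + s ≡ y + t
    combine {x} {y} {u} {v} {s} {t} rows row = +-cancelʳ-≡ (u + v) (x + s) (y + t) (begin
      x + s + (u + v)  ≡⟨ exchange x s u v ⟩
      x + v + (u + s)  ≡⟨ cong₂ _+_ rows row ⟩
      y + u + (v + t)  ≡⟨ exchange y u v t ⟩
      y + t + (v + u)  ≡⟨ cong (y + t +_) (+-comm v u) ⟩
      y + t + (u + v)  ∎)
      where
        open ≡-Reasoning
        exchange : ∀ a b c d → a + b + (c + d) ≡ a + d + (c + b)
        exchange = solve-∀

length-filterᵇ-∷ : ∀ (P : A → Bool) x xs → length (filterᵇ P (x ∷ xs)) ≡ 𝟙 (P x) + length (filterᵇ P xs)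
length-filterᵇ-∷ P x xs with P x
... | true  = refl
... | false = refl

length-filterᵇ-++ : ∀ (P : A → Bool) xs ys →
                    length (filterᵇ P (xs ++ ys)) ≡ length (filterᵇ P xs) + length (filterᵇ P ys)
length-filterᵇ-++ P xs ys = trans (cong length (filter-++ (T? ∘ P) xs ys)) (length-++ (filterᵇ P xs))

length-filterᵇ-map : ∀ (P : B → Bool) (g : A → B) xs →
                     length (filterᵇ P (map g xs)) ≡ length (filterᵇ (P ∘ g) xs)
length-filterᵇ-map P g []       = refl
length-filterᵇ-map P g (x ∷ xs) = trans (length-filterᵇ-∷ P (g x) (map g xs))
  (trans (cong (𝟙 (P (g x)) +_) (length-filterᵇ-map P g xs)) (sym (length-filterᵇ-∷ (P ∘ g) x xs)))

length-filterᵇ-tabulate : ∀ (P : A → Bool) (f : Fin n → A) → length (filterᵇ P (tabulate f)) ≡ count (P ∘ f)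
length-filterᵇ-tabulate {n = zero}  P f = refl
length-filterᵇ-tabulate {n = suc n} P f =
  trans (length-filterᵇ-∷ P (f zero) _) (cong (𝟙 (P (f zero)) +_) (length-filterᵇ-tabulate P (f ∘ suc)))

length-filterᵇ-cartesianProduct : ∀ (P : A × B → Bool) (f : Fin n → A) ys →
  length (filterᵇ P (cartesianProduct (tabulate f) ys)) ≡ ∑ λ i → length (filterᵇ (λ b → P (f i , b)) ys)
length-filterᵇ-cartesianProduct {n = zero}  P f ys = refl
length-filterᵇ-cartesianProduct {n = suc n} P f ys = trans (length-filterᵇ-++ P (map (f zero ,_) ys) _)
  (cong₂ _+_ (length-filterᵇ-map P (f zero ,_) ys) (length-filterᵇ-cartesianProduct P (f ∘ suc) ys))

length-filterᵇ-allPairs : ∀ (P : Fin n × Fin n → Bool) → length (filterᵇ P (allPairs n)) ≡ count² P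
length-filterᵇ-allPairs P = trans (length-filterᵇ-cartesianProduct P id _)
  (∑-cong λ i → length-filterᵇ-tabulate (λ j → P (i , j)) id)

∪-least : {p q r : Subset n} → p ⊆ r → q ⊆ r → p ∪ q ⊆ r
∪-least {p = p} {q} p⊆r q⊆r x∈p∪q = [ p⊆r , q⊆r ] (x∈p∪q⁻ p q x∈p∪q)

∣p∪q∣≤∣p∣+∣q∣ : ∀ (p q : Subset n) → ∣ p ∪ q ∣ ≤ ∣ p ∣ + ∣ q ∣
∣p∪q∣≤∣p∣+∣q∣ []ᵥ            []ᵥ            = z≤n
∣p∪q∣≤∣p∣+∣q∣ (inside  ∷ᵥ p) (s       ∷ᵥ q) =
  s≤s (≤-trans (∣p∪q∣≤∣p∣+∣q∣ p q) (+-monoʳ-≤ ∣ p ∣ (∣p∣≤∣x∷p∣ s q)))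
∣p∪q∣≤∣p∣+∣q∣ (outside ∷ᵥ p) (outside ∷ᵥ q) = ∣p∪q∣≤∣p∣+∣q∣ p q
∣p∪q∣≤∣p∣+∣q∣ (outside ∷ᵥ p) (inside  ∷ᵥ q) =
  ≤-trans (s≤s (∣p∪q∣≤∣p∣+∣q∣ p q)) (≤-reflexive (sym (+-suc ∣ p ∣ ∣ q ∣)))

∣p∪⁅x⁆∣≤1+∣p∣ : ∀ (p : Subset n) x → ∣ p ∪ ⁅ x ⁆ ∣ ≤ suc ∣ p ∣
∣p∪⁅x⁆∣≤1+∣p∣ p x = ≤-trans (∣p∪q∣≤∣p∣+∣q∣ p ⁅ x ⁆)
  (≤-reflexive (trans (cong (∣ p ∣ +_) (∣⁅x⁆∣≡1 x)) (+-comm ∣ p ∣ 1)))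

Covers : CGraph n → Assignment n → Subset n → Set
Covers G f C = ∀ i j → isEdge G (i , j) ≡ true → target f (i , j) ∈ C

mapsTo : CGraph n → Assignment n → Fin n → Fin n × Fin n → Bool
mapsTo G f v e = isEdge G e ∧ ⌊ target f e ≟ v ⌋

load≡count² : ∀ (G : CGraph n) f v → load G f v ≡ count² (mapsTo G f v)
load≡count² G f v = length-filterᵇ-allPairs (mapsTo G f v)

load-positive : ∀ (G : CGraph n) f e → isEdge G e ≡ true → 1 ≤ load G f (target f e)
load-positive G f e edge = subst (1 ≤_) (sym (load≡count² G f (target f e)))
  (count²-≥1 (mapsTo G f (target f e)) e (cong₂ _∧_ edge (⌊⌋-true (target f e ≟ target f e) refl)))

load≡0 : ∀ (G : CGraph n) f v → (∀ i j → isEdge G (i , j) ≡ true → target f (i , j) ≢ v) → load G f v ≡ 0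
load≡0 G f v avoids-v = trans (load≡count² G f v) (count²-zero λ (i , j) → not-mapped i j (isEdge G (i , j)) refl)
  where
    not-mapped : ∀ i j b → isEdge G (i , j) ≡ b → b ∧ ⌊ target f (i , j) ≟ v ⌋ ≡ false
    not-mapped i j false _    = refl
    not-mapped i j true  edge = ⌊⌋-false (target f (i , j) ≟ v) (avoids-v i j edge)

load-uncovered : ∀ (G : CGraph n) f {C} → Covers G f C → ∀ v → v ∉ C → load G f v ≡ 0
load-uncovered G f {C} covers v v∉C = load≡0 G f v λ i j edge t≡v → v∉C (subst (_∈ C) t≡v (covers i j edge))

load≤cap : ∀ {G : CGraph n} {C} → ((f , _ , _) : IsCVC G C) → ∀ v → load G f v ≤ cap G v
load≤cap {G = G} {C} (f , covers , fits) v with v ∈? C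
... | yes v∈C = fits v v∈C
... | no  v∉C = subst (_≤ cap G v) (sym (load-uncovered G f covers v v∉C)) z≤n

-- The invariant maintained along an augmenting path whose current end is z.
record AlmostCVC (H : CGraph m) (S : Subset m) (z : Fin m) (g : Assignment m) : Set where
  field
    covers   : ∀ i j → isEdge H (i , j) ≡ true → target g (i , j) ∈ S ⊎ target g (i , j) ≡ z
    fits     : ∀ v → v ∈ S → v ≢ z → load H g v ≤ cap H v
    z-fits+1 : load H g z ≤ suc (cap H z)
    new-fits : z ∉ S → load H g z ≤ cap H z

  load-outside : ∀ v → v ∉ S → v ≢ z → load H g v ≡ 0
  load-outside v v∉S v≢z = load≡0 H g v λ i j edge t≡v →
    [ (λ t∈S → v∉S (subst (_∈ S) t≡v t∈S)) , (λ t≡z → v≢z (trans (sym t≡v) t≡z)) ] (covers i j edge)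

  overloaded∈S : cap H z < load H g z → z ∈ S
  overloaded∈S overloaded with z ∈? S
  ... | yes z∈S = z∈S
  ... | no  z∉S = contradiction (new-fits z∉S) (<⇒≱ overloaded)

module Augmentation (H : CGraph m) (D : Subset m) (f′ : Assignment m)
                    (f′-covers : Covers H f′ D) (f′-fits : ∀ v → v ∈ D → load H f′ v ≤ cap H v) where

  _≟ₑ_ : (e e′ : Fin m × Fin m) → Dec (e ≡ e′)
  _≟ₑ_ = ≡-dec _≟_ _≟_

  redirect : Assignment m → Fin m × Fin m → Assignment m
  redirect g e i j = if ⌊ (i , j) ≟ₑ e ⌋ then f′ i j else g i j

  target-redirect-≡ : ∀ g e → target (redirect g e) e ≡ target f′ e
  target-redirect-≡ g (i , j) = cong (λ b → if b then i else j)
    (cong (if_then f′ i j else g i j) (⌊⌋-true ((i , j) ≟ₑ (i , j)) refl))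

  target-redirect-≢ : ∀ g e e′ → e′ ≢ e → target (redirect g e) e′ ≡ target g e′
  target-redirect-≢ g e (i , j) e′≢e = cong (λ b → if b then i else j)
    (cong (if_then f′ i j else g i j) (⌊⌋-false ((i , j) ≟ₑ e) e′≢e))

  load-redirect : ∀ g e v → isEdge H e ≡ true →
                  load H (redirect g e) v + 𝟙 ⌊ target g e ≟ v ⌋ ≡ load H g v + 𝟙 ⌊ target f′ e ≟ v ⌋
  load-redirect g e v edge = begin
    load H g′ v + 𝟙 ⌊ target g e ≟ v ⌋
      ≡⟨ cong₂ _+_ (load≡count² H g′ v) (cong (λ b → 𝟙 (b ∧ ⌊ target g e ≟ v ⌋)) (sym edge)) ⟩
    count² (mapsTo H g′ v) + 𝟙 (mapsTo H g v e)
      ≡⟨ count²-swap e (λ e′ e′≢e → cong (λ t → isEdge H e′ ∧ ⌊ t ≟ v ⌋) (target-redirect-≢ g e e′ e′≢e)) ⟩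
    count² (mapsTo H g v) + 𝟙 (mapsTo H g′ v e)
      ≡⟨ cong₂ _+_ (sym (load≡count² H g v)) (cong (λ b → 𝟙 (b ∧ ⌊ target g′ e ≟ v ⌋)) edge) ⟩
    load H g v + 𝟙 ⌊ target g′ e ≟ v ⌋
      ≡⟨ cong (λ t → load H g v + 𝟙 ⌊ t ≟ v ⌋) (target-redirect-≡ g e) ⟩
    load H g v + 𝟙 ⌊ target f′ e ≟ v ⌋
      ∎
    where
      open ≡-Reasoning
      g′ : Assignment m
      g′ = redirect g e

  disagrees : Assignment m → Fin m × Fin m → Bool
  disagrees g e = isEdge H e ∧ not ⌊ target g e ≟ target f′ e ⌋

  disagreement : Assignment m → ℕ
  disagreement g = count² (disagrees g)

  disagreement-redirect : ∀ g e → isEdge H e ≡ true → target g e ≢ target f′ e →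
                          disagreement g ≡ suc (disagreement (redirect g e))
  disagreement-redirect g e edge g≢f′ = 𝟙-shift
    (count²-swap e λ e′ e′≢e → cong (λ t → isEdge H e′ ∧ not ⌊ t ≟ target f′ e′ ⌋) (target-redirect-≢ g e e′ e′≢e))
    (cong₂ _∧_ edge (cong not (⌊⌋-false (target g e ≟ target f′ e) g≢f′)))
    (cong₂ _∧_ edge (cong not (⌊⌋-true (target (redirect g e) e ≟ target f′ e) (target-redirect-≡ g e))))

  AlmostCVC-redirect : ∀ {g S z} e → AlmostCVC H S z g → z ∈ S →
                       isEdge H e ≡ true → target g e ≡ z → target f′ e ≢ z →
                       AlmostCVC H S (target f′ e) (redirect g e)
  AlmostCVC-redirect {g} {S} e inv z∈S edge refl w≢z = record
    { covers = covers′ ; fits = fits′ ; z-fits+1 = w-fits+1 ; new-fits = w-new-fits }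
    where
      open AlmostCVC inv
      z w : Fin _
      z = target g e
      w = target f′ e
      g′ : Assignment _
      g′ = redirect g e

      load-z : load H g z ≡ suc (load H g′ z)
      load-z = 𝟙-shift (load-redirect g e z edge) (⌊⌋-true (z ≟ z) refl) (⌊⌋-false (w ≟ z) w≢z)

      load-w : load H g′ w ≡ suc (load H g w)
      load-w = 𝟙-shift (sym (load-redirect g e w edge)) (⌊⌋-true (w ≟ w) refl) (⌊⌋-false (z ≟ w) (w≢z ∘ sym))

      load-other : ∀ v → v ≢ z → v ≢ w → load H g′ v ≡ load H g v
      load-other v v≢z v≢w =
        𝟙-cancel (load-redirect g e v edge) (⌊⌋-false (z ≟ v) (v≢z ∘ sym)) (⌊⌋-false (w ≟ v) (v≢w ∘ sym))

      covers′ : ∀ i j → isEdge H (i , j) ≡ true → target g′ (i , j) ∈ S ⊎ target g′ (i , j) ≡ w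
      covers′ i j edge′ with (i , j) ≟ₑ e
      ... | yes refl = inj₂ refl
      ... | no  _    = inj₁ ([ id , (λ t≡z → subst (_∈ S) (sym t≡z) z∈S) ] (covers i j edge′))

      fits′ : ∀ v → v ∈ S → v ≢ w → load H g′ v ≤ cap H v
      fits′ v v∈S v≢w with v ≟ z
      ... | yes refl = s≤s⁻¹ (subst (_≤ suc (cap H z)) load-z z-fits+1)
      ... | no  v≢z  = subst (_≤ cap H v) (sym (load-other v v≢z v≢w)) (fits v v∈S v≢z)

      load-g-w : load H g w ≤ cap H w
      load-g-w with w ∈? S
      ... | yes w∈S = fits w w∈S w≢z
      ... | no  w∉S = subst (_≤ cap H w) (sym (load-outside w w∉S w≢z)) z≤n

      w-fits+1 : load H g′ w ≤ suc (cap H w)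
      w-fits+1 = subst (_≤ suc (cap H w)) (sym load-w) (s≤s load-g-w)

      w-new-fits : w ∉ S → load H g′ w ≤ cap H w
      w-new-fits w∉S = begin
        load H g′ w       ≡⟨ load-w ⟩
        suc (load H g w)  ≡⟨ cong suc (load-outside w w∉S w≢z) ⟩
        1                 ≤⟨ load-positive H f′ e edge ⟩
        load H f′ w       ≤⟨ f′-fits w (f′-covers (proj₁ e) (proj₂ e) edge) ⟩
        cap H w           ∎
        where open ≤-Reasoning

  misplaced-edge : ∀ g z → z ∈ D → cap H z < load H g z →
                   ∃[ e ] isEdge H e ≡ true × target g e ≡ z × target f′ e ≢ z
  misplaced-edge g z z∈D overloaded =
    let e , g↦z , f′↛z = count²-<⇒ f′<g
        edge = ∧-conicalˡ _ _ g↦z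
    in e , edge , ⌊⌋-true⇒ (target g e ≟ z) (∧-conicalʳ _ _ g↦z) ,
       λ f′↦z → contradiction (trans (sym f′↛z) (cong₂ _∧_ edge (⌊⌋-true (target f′ e ≟ z) f′↦z))) λ ()
    where
      f′<g : count² (mapsTo H f′ z) < count² (mapsTo H g z)
      f′<g = subst₂ _<_ (load≡count² H f′ z) (load≡count² H g z) (≤-<-trans (f′-fits z z∈D) overloaded)

  AugmentedCover : Subset m → Set
  AugmentedCover S = ∃[ T ] T ⊆ S ∪ D × IsCVC H T × ∣ T ∣ ≤ suc ∣ S ∣

  AlmostCVC⇒AugmentedCover : ∀ {g S z} → z ∈ D → AlmostCVC H S z g → load H g z ≤ cap H z → AugmentedCover S
  AlmostCVC⇒AugmentedCover {g} {S} {z} z∈D inv z-fits =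
    S ∪ ⁅ z ⁆ , T⊆S∪D , (g , covers′ , fits′) , ∣p∪⁅x⁆∣≤1+∣p∣ S z
    where
      open AlmostCVC inv
      T⊆S∪D : S ∪ ⁅ z ⁆ ⊆ S ∪ D
      T⊆S∪D = ∪-least (p⊆p∪q D) (λ x∈⁅z⁆ → q⊆p∪q S D (subst (_∈ D) (sym (x∈⁅y⁆⇒x≡y z x∈⁅z⁆)) z∈D))
      covers′ : Covers H g (S ∪ ⁅ z ⁆)
      covers′ i j edge = x∈p∪q⁺ (map₂ (λ t≡z → subst (_∈ ⁅ z ⁆) (sym t≡z) (x∈⁅x⁆ z)) (covers i j edge))
      fits′ : ∀ v → v ∈ S ∪ ⁅ z ⁆ → load H g v ≤ cap H v
      fits′ v v∈T with v ≟ z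
      ... | yes refl = z-fits
      ... | no  v≢z  = fits v ([ id , (λ v∈⁅z⁆ → contradiction (x∈⁅y⁆⇒x≡y z v∈⁅z⁆) v≢z) ] (x∈p∪q⁻ S ⁅ z ⁆ v∈T)) v≢z

  -- The fuel k bounds the disagreement with f′, which every redirection lowers.
  augment-within : ∀ k {g S z} → disagreement g < k → z ∈ D → AlmostCVC H S z g → AugmentedCover S
  augment-within (suc k) {g} {S} {z} d<k z∈D inv with load H g z ≤? cap H z
  ... | yes z-fits = AlmostCVC⇒AugmentedCover z∈D inv z-fits
  ... | no  z-unfit =
    let overloaded = ≰⇒> z-unfit
        e , edge , g↦z , f′↛z = misplaced-edge g z z∈D overloaded
    in augment-within k
         (subst (_≤ k) (disagreement-redirect g e edge (λ g≡f′ → f′↛z (trans (sym g≡f′) g↦z))) (s≤s⁻¹ d<k))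
         (f′-covers (proj₁ e) (proj₂ e) edge)
         (AlmostCVC-redirect e inv (AlmostCVC.overloaded∈S inv overloaded) edge g↦z f′↛z)

  augment : ∀ {g S z} → z ∈ D → AlmostCVC H S z g → AugmentedCover S
  augment {g} = augment-within (suc (disagreement g)) ≤-refl

restrict : Assignment (suc n) → Assignment n
restrict g i j = g (suc i) (suc j)

-- The pendant edge {zero , suc j} is sent to suc j, since false selects the second endpoint.
extend : Assignment n → Assignment (suc n)
extend f (suc i) (suc j) = f i j
extend f _       _       = false

target-suc : ∀ (g : Assignment (suc n)) i j → target g (suc i , suc j) ≡ suc (target (restrict g) (i , j))
target-suc g i j with g (suc i) (suc j)
... | true  = refl
... | false = refl

module Pendant (G : CGraph n) (cx : ℕ) (y : Fin n) where

  H : CGraph (suc n)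
  H = addPendant G cx y

  isEdge-suc : ∀ i j → isEdge H (suc i , suc j) ≡ isEdge G (i , j)
  isEdge-suc i j = cong (_∧ adj G i j) (⌊⌋-⇔ (mk⇔ s≤s⁻¹ s≤s) (suc (toℕ i) <? suc (toℕ j)) (toℕ i <? toℕ j))

  mapsTo-suc : ∀ g v i j → mapsTo H g (suc v) (suc i , suc j) ≡ mapsTo G (restrict g) v (i , j)
  mapsTo-suc g v i j = cong₂ _∧_ (isEdge-suc i j)
    (trans (cong (λ t → ⌊ t ≟ suc v ⌋) (target-suc g i j)) (⌊⌋-⇔ (mk⇔ suc-injective (cong suc)) _ _))

  load-suc : ∀ g v → load H g (suc v) ≡ 𝟙 ⌊ target g (zero , suc y) ≟ suc v ⌋ + load G (restrict g) v
  load-suc g v = begin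
    load H g (suc v)                                                         ≡⟨ load≡count² H g (suc v) ⟩
    count² (mapsTo H g (suc v))                                              ≡⟨ cong₂ _+_ pendant-row old-rows ⟩
    𝟙 ⌊ target g (zero , suc y) ≟ suc v ⌋ + count² (mapsTo G (restrict g) v)  ≡⟨ cong (_ +_) (load≡count² G (restrict g) v) ⟨
    𝟙 ⌊ target g (zero , suc y) ≟ suc v ⌋ + load G (restrict g) v            ∎
    where
      open ≡-Reasoning
      pendant-row : count (λ j → mapsTo H g (suc v) (zero , j)) ≡ 𝟙 ⌊ target g (zero , suc y) ≟ suc v ⌋
      pendant-row = trans
        (∑-single y λ j j≢y → cong (λ b → 𝟙 (b ∧ ⌊ target g (zero , suc j) ≟ suc v ⌋)) (⌊⌋-false (j ≟ y) j≢y))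
        (cong (λ b → 𝟙 (b ∧ ⌊ target g (zero , suc y) ≟ suc v ⌋)) (⌊⌋-true (y ≟ y) refl))
      old-rows : ∑ (λ i → count λ j → mapsTo H g (suc v) (suc i , j)) ≡ count² (mapsTo G (restrict g) v)
      old-rows = ∑-cong λ i → ∑-cong λ j → cong 𝟙 (mapsTo-suc g v i j)

  restrictCover : ∀ {D} → IsCVC H (outside ∷ᵥ D) → IsCVC G D
  restrictCover {D} (g , covers , fits) = restrict g , covers′ , fits′
    where
      covers′ : Covers G (restrict g) D
      covers′ i j edge = drop-there (subst (_∈ outside ∷ᵥ D) (target-suc g i j)
                                      (covers (suc i) (suc j) (trans (isEdge-suc i j) edge)))
      fits′ : ∀ v → v ∈ D → load G (restrict g) v ≤ cap G v
      fits′ v v∈D = ≤-trans (m≤n+m _ _) (subst (_≤ cap G v) (load-suc g v) (fits (suc v) (there v∈D)))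

  extendCover : ∀ {C D} → IsCVC G C → IsCVC H (outside ∷ᵥ D) →
                ∃[ T ] T ⊆ (outside ∷ᵥ C) ∪ (outside ∷ᵥ D) × IsCVC H T × ∣ T ∣ ≤ suc ∣ C ∣
  extendCover {C} {D} C-cvc@(f , covers , fits) (f′ , f′-covers , f′-fits) = augment y∈D′ almost
    where
      open Augmentation H (outside ∷ᵥ D) f′ f′-covers f′-fits using (augment)

      pendant : isEdge H (zero , suc y) ≡ true
      pendant = ⌊⌋-true (y ≟ y) refl

      f′-pendant : target f′ (zero , suc y) ≡ suc y
      f′-pendant with f′ zero (suc y) | f′-covers zero (suc y) pendant
      ... | false | _  = refl
      ... | true  | ()

      y∈D′ : suc y ∈ outside ∷ᵥ D
      y∈D′ = subst (_∈ outside ∷ᵥ D) f′-pendant (f′-covers zero (suc y) pendant)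

      load-extend : ∀ v → load H (extend f) (suc v) ≡ 𝟙 ⌊ suc y ≟ suc v ⌋ + load G f v
      load-extend = load-suc (extend f)

      covers′ : ∀ i j → isEdge H (i , j) ≡ true →
                target (extend f) (i , j) ∈ outside ∷ᵥ C ⊎ target (extend f) (i , j) ≡ suc y
      covers′ zero    (suc j) edge = inj₂ (cong suc (⌊⌋-true⇒ (j ≟ y) edge))
      covers′ (suc i) (suc j) edge = inj₁ (subst (_∈ outside ∷ᵥ C) (sym (target-suc (extend f) i j))
                                              (there (covers i j (trans (sym (isEdge-suc i j)) edge))))

      fits′ : ∀ v → v ∈ outside ∷ᵥ C → v ≢ suc y → load H (extend f) v ≤ cap H v
      fits′ (suc v) (there v∈C) v≢y = subst (_≤ cap G v)
        (sym (trans (load-extend v) (cong (λ b → 𝟙 b + load G f v) (⌊⌋-false (suc y ≟ suc v) (v≢y ∘ sym)))))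
        (fits v v∈C)

      y-fits+1 : load H (extend f) (suc y) ≤ suc (cap G y)
      y-fits+1 = subst (_≤ suc (cap G y)) (sym (load-extend y)) (+-mono-≤ (𝟙≤1 _) (load≤cap C-cvc y))

      y-new-fits : suc y ∉ outside ∷ᵥ C → load H (extend f) (suc y) ≤ cap G y
      y-new-fits y∉C′ = begin
        load H (extend f) (suc y)             ≡⟨ load-extend y ⟩
        𝟙 ⌊ suc y ≟ suc y ⌋ + load G f y      ≡⟨ cong (_ +_) (load-uncovered G f covers y (y∉C′ ∘ there)) ⟩
        𝟙 ⌊ suc y ≟ suc y ⌋ + 0               ≤⟨ +-monoˡ-≤ 0 (𝟙≤1 _) ⟩
        1                                     ≤⟨ load-positive H f′ (zero , suc y) pendant ⟩
        load H f′ (target f′ (zero , suc y))  ≡⟨ cong (load H f′) f′-pendant ⟩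
        load H f′ (suc y)                     ≤⟨ f′-fits (suc y) y∈D′ ⟩
        cap G y                               ∎
        where open ≤-Reasoning

      almost : AlmostCVC H (outside ∷ᵥ C) (suc y) (extend f)
      almost = record { covers = covers′ ; fits = fits′ ; z-fits+1 = y-fits+1 ; new-fits = y-new-fits }

≤∧≤suc⇒≡∨≡suc : ∀ {a b} → a ≤ b → b ≤ suc a → b ≡ a ⊎ b ≡ suc a
≤∧≤suc⇒≡∨≡suc a≤b b≤1+a with m≤n⇒m<n∨m≡n a≤b
... | inj₁ a<b = inj₂ (≤-antisym b≤1+a a<b)
... | inj₂ a≡b = inj₁ (sym a≡b)

lemma4p3 : ∀ {n} (G : CGraph n) (U : Subset n) (cx : ℕ) (y : Fin n) (m m' : ℕ∞) →
             CvcIs G U m → CvcIs (addPendant G cx y) (liftU U) m' →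
             m' ≡ m ⊎ m' ≡ suc∞ m ⊎ m' ≡ nothing
lemma4p3 G U cx y m .nothing _ (infinite _) = inj₂ (inj₂ refl)
lemma4p3 G U cx y m _ _ (finite (inside ∷ᵥ _) D′⊆U′ _ _) with D′⊆U′ here
... | ()
lemma4p3 G U cx y m _ (infinite no-cover) (finite (outside ∷ᵥ D) D′⊆U′ D′-cvc _) =
  ⊥-elim (no-cover D (drop-∷-⊆ D′⊆U′) (Pendant.restrictCover G cx y D′-cvc))
lemma4p3 G U cx y m _ (finite C C⊆U C-cvc C-min) (finite (outside ∷ᵥ D) D′⊆U′ D′-cvc D′-min) =
  let T , T⊆C∪D , T-cvc , ∣T∣≤1+∣C∣ = extendCover C-cvc D′-cvc
      ∣C∣≤∣D∣ = C-min D D⊆U (restrictCover D′-cvc)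
      ∣D∣≤∣T∣ = D′-min T (⊆-trans T⊆C∪D (out⊆ (∪-least C⊆U D⊆U))) T-cvc
  in [ inj₁ ∘ cong just , inj₂ ∘ inj₁ ∘ cong just ] (≤∧≤suc⇒≡∨≡suc ∣C∣≤∣D∣ (≤-trans ∣D∣≤∣T∣ ∣T∣≤1+∣C∣))
  where
    open Pendant G cx y
    D⊆U : D ⊆ U
    D⊆U = drop-∷-⊆ D′⊆U′
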